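{- For every $\Sigma_1$-sentence $\lambda$ of $\mathbb{L}_{\sf a}$ one can effectively find a pure 1-$\Sigma_1$-sentence $\lambda^{\bullet}$ such that (1) $\mathbb{N} \models \lambda \leftrightarrow \lambda^{\bullet}$, and (2) $\lambda^{\bullet} \to \lambda$ is logically valid.
   Context: $\mathbb{L}_{\sf a}$ is the signature $\{0, \mathsf{S}, +, \times, \leq\}$ with $\leq$ primitive; the logic has no primitive $\top,\bot$. A $\Sigma_1$-formula is one of the form $\exists\vec{x}\,\delta$ with $\delta$ a $\Delta_0$ (bounded-quantifier) formula. A pure $\Delta_0$-formula is a $\Delta_0$-formula in which every atomic formula $t_1 \leq t_2$ has both $t_1,t_2$ variables (so bounded quantifiers are bounded by variables), and every atomic formula $t_1 = t_2$ is of one of the forms $x_0 = x_1$, $0 = x_0$, $\mathsf{S}x_0 = x_1$, $x_0 + x_1 = x_2$, $x_0 \times x_1 = x_2$ with $x_0,x_1,x_2$ variables. A pure 1-$\Sigma_1$-sentence is a sentence of the form $\exists x\,\sigma_0(x)$ with $\sigma_0(x)$ a pure $\Delta_0$-formula (with only $x$ free). -}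

module Defs where

open import Data.Nat as Nat using (ℕ)
open import Data.Fin using (Fin; zero; suc)
open import Data.Vec using (Vec; []; _∷_; lookup)
open import Data.Product using (Σ; _×_; _,_)
open import Data.Sum using (_⊎_)
open import Relation.Nullary using (¬_)
open import Relation.Binary.PropositionalEquality using (_≡_)

data Term (n : ℕ) : Set where
  var  : Fin n → Term n
  `0   : Term n
  `S   : Term n → Term n
  _`+_ : Term n → Term n → Term n
  _`×_ : Term n → Term n → Term n

data Formula (n : ℕ) : Set where
  _≐_  : Term n → Term n → Formula n
  _≼_  : Term n → Term n → Formula n
  ¬'_  : Formula n → Formula n
  _∧'_ : Formula n → Formula n → Formula n
  _∨'_ : Formula n → Formula n → Formula n
  _⇒'_ : Formula n → Formula n → Formula n
  ∀'   : Formula (Nat.suc n) → Formula n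
  ∃'   : Formula (Nat.suc n) → Formula n

Sentence : Set
Sentence = Formula 0

_⇔'_ : ∀ {n} → Formula n → Formula n → Formula n
φ ⇔' ψ = (φ ⇒' ψ) ∧' (ψ ⇒' φ)

wk : ∀ {n} → Term n → Term (Nat.suc n)
wk (var i)   = var (suc i)
wk `0        = `0
wk (`S t)    = `S (wk t)
wk (t `+ u)  = wk t `+ wk u
wk (t `× u)  = wk t `× wk u

∀≤ : ∀ {n} → Term n → Formula (Nat.suc n) → Formula n
∀≤ t φ = ∀' ((var zero ≼ wk t) ⇒' φ)

∃≤ : ∀ {n} → Term n → Formula (Nat.suc n) → Formula n
∃≤ t φ = ∃' ((var zero ≼ wk t) ∧' φ)

data IsΔ0 {n : ℕ} : Formula n → Set where
  eq   : ∀ t u → IsΔ0 (t ≐ u)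
  le   : ∀ t u → IsΔ0 (t ≼ u)
  neg  : ∀ {φ} → IsΔ0 φ → IsΔ0 (¬' φ)
  conj : ∀ {φ ψ} → IsΔ0 φ → IsΔ0 ψ → IsΔ0 (φ ∧' ψ)
  disj : ∀ {φ ψ} → IsΔ0 φ → IsΔ0 ψ → IsΔ0 (φ ∨' ψ)
  imp  : ∀ {φ ψ} → IsΔ0 φ → IsΔ0 ψ → IsΔ0 (φ ⇒' ψ)
  ball : ∀ t {φ} → IsΔ0 φ → IsΔ0 (∀≤ t φ)
  bex  : ∀ t {φ} → IsΔ0 φ → IsΔ0 (∃≤ t φ)

data IsΣ1 {n : ℕ} : Formula n → Set where
  delta : ∀ {φ} → IsΔ0 φ → IsΣ1 φ
  ex    : ∀ {φ} → IsΣ1 φ → IsΣ1 (∃' φ)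

data IsPureΔ0 {n : ℕ} : Formula n → Set where
  p-le   : ∀ i j → IsPureΔ0 (var i ≼ var j)
  p-eq   : ∀ i j → IsPureΔ0 (var i ≐ var j)
  p-zero : ∀ i → IsPureΔ0 (`0 ≐ var i)
  p-suc  : ∀ i j → IsPureΔ0 (`S (var i) ≐ var j)
  p-add  : ∀ i j k → IsPureΔ0 ((var i `+ var j) ≐ var k)
  p-mul  : ∀ i j k → IsPureΔ0 ((var i `× var j) ≐ var k)
  p-neg  : ∀ {φ} → IsPureΔ0 φ → IsPureΔ0 (¬' φ)
  p-conj : ∀ {φ ψ} → IsPureΔ0 φ → IsPureΔ0 ψ → IsPureΔ0 (φ ∧' ψ)
  p-disj : ∀ {φ ψ} → IsPureΔ0 φ → IsPureΔ0 ψ → IsPureΔ0 (φ ∨' ψ)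
  p-imp  : ∀ {φ ψ} → IsPureΔ0 φ → IsPureΔ0 ψ → IsPureΔ0 (φ ⇒' ψ)
  p-ball : ∀ i {φ} → IsPureΔ0 φ → IsPureΔ0 (∀≤ (var i) φ)
  p-bex  : ∀ i {φ} → IsPureΔ0 φ → IsPureΔ0 (∃≤ (var i) φ)

data IsPure1Σ1 : Sentence → Set where
  pure1 : ∀ {σ₀ : Formula 1} → IsPureΔ0 σ₀ → IsPure1Σ1 (∃' σ₀)

-- Semantics: L_a-structures (= interpreted as identity), classical
-- Tarski semantics rendered via double negation (Gödel–Gentzen style),
-- which is classically equivalent to the usual Tarski truth definition.

record Structure : Set₁ where
  field
    Carrier : Set
    z       : Carrier
    s       : Carrier → Carrier
    add     : Carrier → Carrier → Carrier
    mul     : Carrier → Carrier → Carrier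
    leq     : Carrier → Carrier → Set

module _ (M : Structure) where
  open Structure M

  evalT : ∀ {n} → Vec Carrier n → Term n → Carrier
  evalT ρ (var i)  = lookup ρ i
  evalT ρ `0       = z
  evalT ρ (`S t)   = s (evalT ρ t)
  evalT ρ (t `+ u) = add (evalT ρ t) (evalT ρ u)
  evalT ρ (t `× u) = mul (evalT ρ t) (evalT ρ u)

  Sat : ∀ {n} → Vec Carrier n → Formula n → Set
  Sat ρ (t ≐ u)  = ¬ ¬ (evalT ρ t ≡ evalT ρ u)
  Sat ρ (t ≼ u)  = ¬ ¬ (leq (evalT ρ t) (evalT ρ u))
  Sat ρ (¬' φ)   = ¬ Sat ρ φ
  Sat ρ (φ ∧' ψ) = Sat ρ φ × Sat ρ ψ
  Sat ρ (φ ∨' ψ) = ¬ ¬ (Sat ρ φ ⊎ Sat ρ ψ)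
  Sat ρ (φ ⇒' ψ) = Sat ρ φ → Sat ρ ψ
  Sat ρ (∀' φ)   = (a : Carrier) → Sat (a ∷ ρ) φ
  Sat ρ (∃' φ)   = ¬ ¬ (Σ Carrier λ a → Sat (a ∷ ρ) φ)

_⊨_ : Structure → Sentence → Set
M ⊨ φ = Sat M [] φ

Valid : Sentence → Set₁
Valid φ = (M : Structure) → M ⊨ φ

ℕ-model : Structure
ℕ-model = record
  { Carrier = ℕ ; z = 0 ; s = Nat.suc ; add = Nat._+_ ; mul = Nat._*_ ; leq = Nat._≤_ }

{-# OPTIONS --safe #-}
module Submission where

-- Name the value of every compound subterm by a fresh variable, defined by a pure atomic
-- equation such as S x = z or x + y = z. In positive positions the new variable is
-- quantified existentially, in negative ones universally; all these quantifiers, and the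
-- existentials of the Σ1-prefix, are bounded by a single new variable y. In any structure
-- the translation then implies the original formula, because the defining equations force
-- the named values. In ℕ, as soon as y exceeds every value met while evaluating the
-- formula (a bound computed recursively, summing over the range of each bounded
-- quantifier), the translation is equivalent to the original, so ∃y of it holds whenever
-- the given Σ1-sentence does.

open import Defs
open import Data.Product using (Σ-syntax; _×_; _,_)
import Data.Product as Product
import Data.Sum as Sum
open import Data.Nat as ℕ using (ℕ; _≤_; _+_; z≤n; _≤?_)
open import Data.Nat.Properties
  using (≤-refl; ≤-trans; m≤m+n; m≤n+m; m+n≤o⇒m≤o; m+n≤o⇒n≤o; m≤n⇒m<n∨m≡n)
open import Data.Fin using (Fin; zero; suc)
open import Data.Vec using (Vec; []; _∷_; lookup)
open import Data.Vec.Functional using () renaming (_∷_ to _∷ᶠ_)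
open import Data.Product.Function.NonDependent.Propositional using (_×-⇔_)
open import Data.Sum.Function.Propositional using (_⊎-⇔_)
open import Effect.Monad using (RawMonad)
open import Function using (_∘_; id; _⇔_; mk⇔; Equivalence)
open import Function.Construct.Identity using (⇔-id)
open import Function.Construct.Symmetry using (⇔-sym)
open import Function.Construct.Composition using (_⇔-∘_)
open import Function.Related.TypeIsomorphisms using (¬-cong-⇔; →-cong-⇔)
open import Relation.Nullary using (¬_)
open import Relation.Nullary.Negation
  using (¬¬-map; ¬¬-Monad; Stable; negated-stable; contradiction)
open import Relation.Nullary.Decidable using (decidable-stable)
open import Relation.Binary.PropositionalEquality using (_≡_; refl; sym; trans; cong; cong₂; subst)

open Equivalence using (to; from)

Renaming : ℕ → ℕ → Set
Renaming n m = Fin n → Fin m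

lift : ∀ {n m} → Renaming n m → Renaming (ℕ.suc n) (ℕ.suc m)
lift ρ zero    = zero
lift ρ (suc i) = suc (ρ i)

renameᵗ : ∀ {n m} → Renaming n m → Term n → Term m
renameᵗ ρ (var i)  = var (ρ i)
renameᵗ ρ `0       = `0
renameᵗ ρ (`S t)   = `S (renameᵗ ρ t)
renameᵗ ρ (t `+ u) = renameᵗ ρ t `+ renameᵗ ρ u
renameᵗ ρ (t `× u) = renameᵗ ρ t `× renameᵗ ρ u

rename : ∀ {n m} → Renaming n m → Formula n → Formula m
rename ρ (t ≐ u)  = renameᵗ ρ t ≐ renameᵗ ρ u
rename ρ (t ≼ u)  = renameᵗ ρ t ≼ renameᵗ ρ u
rename ρ (¬' φ)   = ¬' rename ρ φ
rename ρ (φ ∧' ψ) = rename ρ φ ∧' rename ρ ψ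
rename ρ (φ ∨' ψ) = rename ρ φ ∨' rename ρ ψ
rename ρ (φ ⇒' ψ) = rename ρ φ ⇒' rename ρ ψ
rename ρ (∀' φ)   = ∀' (rename (lift ρ) φ)
rename ρ (∃' φ)   = ∃' (rename (lift ρ) φ)

rename-pure : ∀ {n m} (ρ : Renaming n m) {φ} → IsPureΔ0 φ → IsPureΔ0 (rename ρ φ)
rename-pure ρ (p-le i j)    = p-le (ρ i) (ρ j)
rename-pure ρ (p-eq i j)    = p-eq (ρ i) (ρ j)
rename-pure ρ (p-zero i)    = p-zero (ρ i)
rename-pure ρ (p-suc i j)   = p-suc (ρ i) (ρ j)
rename-pure ρ (p-add i j k) = p-add (ρ i) (ρ j) (ρ k)
rename-pure ρ (p-mul i j k) = p-mul (ρ i) (ρ j) (ρ k)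
rename-pure ρ (p-neg p)     = p-neg (rename-pure ρ p)
rename-pure ρ (p-conj p q)  = p-conj (rename-pure ρ p) (rename-pure ρ q)
rename-pure ρ (p-disj p q)  = p-disj (rename-pure ρ p) (rename-pure ρ q)
rename-pure ρ (p-imp p q)   = p-imp (rename-pure ρ p) (rename-pure ρ q)
rename-pure ρ (p-ball i p)  = p-ball (ρ i) (rename-pure (lift ρ) p)
rename-pure ρ (p-bex i p)   = p-bex (ρ i) (rename-pure (lift ρ) p)

record Agree {A : Set} {n m} (ρ : Renaming n m) (δ : Vec A m) (γ : Vec A n) : Set where
  constructor agree
  field lookup-agree : ∀ i → lookup δ (ρ i) ≡ lookup γ i

open Agree

agree-id : ∀ {A : Set} {n} {γ : Vec A n} → Agree id γ γ
agree-id = agree λ _ → refl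

agree-weaken : ∀ {A : Set} {n m} {ρ : Renaming n m} {δ γ} {a : A} →
  Agree ρ δ γ → Agree (suc ∘ ρ) (a ∷ δ) γ
agree-weaken ag = agree (lookup-agree ag)

agree-lift : ∀ {A : Set} {n m} {ρ : Renaming n m} {δ γ} (a : A) →
  Agree ρ δ γ → Agree (lift ρ) (a ∷ δ) (a ∷ γ)
agree-lift a ag = agree λ { zero → refl ; (suc i) → lookup-agree ag i }

agree-var : ∀ {A : Set} {n m} {ρ : Renaming n m} {δ γ} →
  Agree ρ δ γ → (i : Fin n) → Agree (ρ i ∷ᶠ id) δ (lookup {A = A} γ i ∷ δ)
agree-var ag i = agree λ { zero → lookup-agree ag i ; (suc j) → refl }

¬¬-cong₂ : ∀ {A B : Set} (R : A → B → Set) {a a′ b b′} → a ≡ a′ → b ≡ b′ →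
  (¬ ¬ R a b) ⇔ (¬ ¬ R a′ b′)
¬¬-cong₂ R refl refl = ⇔-id _

data Polarity : Set where
  ⁺ ⁻ : Polarity

opposite : Polarity → Polarity
opposite ⁺ = ⁻
opposite ⁻ = ⁺

define : ∀ {m} → Polarity → Fin m → Term m → Formula (ℕ.suc m) → Formula m
define ⁺ y e K = ∃≤ (var y) ((wk e ≐ var zero) ∧' K)
define ⁻ y e K = ∀≤ (var y) ((wk e ≐ var zero) ⇒' K)

-- In the continuation K, var zero stands for the value of the flattened term t, and ρ
-- sends the variables of t to those of the surrounding context.
flatten : ∀ {n m} → Polarity → Fin m → Renaming n m → Term n → Formula (ℕ.suc m) → Formula m
flatten₂ : ∀ {n m} → Polarity → Fin m → Renaming n m → Term n → Term n →
  Formula (ℕ.suc (ℕ.suc m)) → Formula m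
flatten p y ρ (var i)  K = rename (ρ i ∷ᶠ id) K
flatten p y ρ `0       K = define p y `0 K
flatten p y ρ (`S t)   K =
  flatten p y ρ t (define p (suc y) (`S (var zero)) (rename (lift suc) K))
flatten p y ρ (t `+ u) K = flatten₂ p y ρ t u
  (define p (suc (suc y)) (var (suc zero) `+ var zero) (rename (lift (suc ∘ suc)) K))
flatten p y ρ (t `× u) K = flatten₂ p y ρ t u
  (define p (suc (suc y)) (var (suc zero) `× var zero) (rename (lift (suc ∘ suc)) K))
flatten₂ p y ρ t u K = flatten p y ρ t (flatten p (suc y) (suc ∘ ρ) u K)

translate : ∀ {n m} → Polarity → Fin m → Renaming n m → {φ : Formula n} → IsΔ0 φ → Formula m
translate p y ρ (eq t u)   = flatten₂ p y ρ t u (var (suc zero) ≐ var zero)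
translate p y ρ (le t u)   = flatten₂ p y ρ t u (var (suc zero) ≼ var zero)
translate p y ρ (neg d)    = ¬' translate (opposite p) y ρ d
translate p y ρ (conj d e) = translate p y ρ d ∧' translate p y ρ e
translate p y ρ (disj d e) = translate p y ρ d ∨' translate p y ρ e
translate p y ρ (imp d e)  = translate (opposite p) y ρ d ⇒' translate p y ρ e
translate p y ρ (ball t d) =
  flatten p y ρ t (∀≤ (var zero) (translate p (suc (suc y)) (lift (suc ∘ ρ)) d))
translate p y ρ (bex t d)  =
  flatten p y ρ t (∃≤ (var zero) (translate p (suc (suc y)) (lift (suc ∘ ρ)) d))

translateΣ : ∀ {n m} → Fin m → Renaming n m → {φ : Formula n} → IsΣ1 φ → Formula m
translateΣ y ρ (delta d) = translate ⁺ y ρ d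
translateΣ y ρ (ex s)    = ∃≤ (var y) (translateΣ (suc y) (lift ρ) s)

define-pure : ∀ p {m} (y : Fin m) {e K} →
  IsPureΔ0 (wk e ≐ var zero) → IsPureΔ0 K → IsPureΔ0 (define p y e K)
define-pure ⁺ y e-pure K-pure = p-bex y (p-conj e-pure K-pure)
define-pure ⁻ y e-pure K-pure = p-ball y (p-imp e-pure K-pure)

flatten-pure : ∀ p {n m} (y : Fin m) (ρ : Renaming n m) t {K} →
  IsPureΔ0 K → IsPureΔ0 (flatten p y ρ t K)
flatten₂-pure : ∀ p {n m} (y : Fin m) (ρ : Renaming n m) t u {K} →
  IsPureΔ0 K → IsPureΔ0 (flatten₂ p y ρ t u K)
flatten-pure p y ρ (var i)  K-pure = rename-pure _ K-pure
flatten-pure p y ρ `0       K-pure = define-pure p y (p-zero zero) K-pure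
flatten-pure p y ρ (`S t)   K-pure =
  flatten-pure p y ρ t (define-pure p (suc y) (p-suc _ _) (rename-pure _ K-pure))
flatten-pure p y ρ (t `+ u) K-pure =
  flatten₂-pure p y ρ t u (define-pure p (suc (suc y)) (p-add _ _ _) (rename-pure _ K-pure))
flatten-pure p y ρ (t `× u) K-pure =
  flatten₂-pure p y ρ t u (define-pure p (suc (suc y)) (p-mul _ _ _) (rename-pure _ K-pure))
flatten₂-pure p y ρ t u K-pure = flatten-pure p y ρ t (flatten-pure p (suc y) (suc ∘ ρ) u K-pure)

translate-pure : ∀ p {n m} (y : Fin m) (ρ : Renaming n m) {φ} (d : IsΔ0 φ) →
  IsPureΔ0 (translate p y ρ d)
translate-pure p y ρ (eq t u)   = flatten₂-pure p y ρ t u (p-eq _ _)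
translate-pure p y ρ (le t u)   = flatten₂-pure p y ρ t u (p-le _ _)
translate-pure p y ρ (neg d)    = p-neg (translate-pure (opposite p) y ρ d)
translate-pure p y ρ (conj d e) = p-conj (translate-pure p y ρ d) (translate-pure p y ρ e)
translate-pure p y ρ (disj d e) = p-disj (translate-pure p y ρ d) (translate-pure p y ρ e)
translate-pure p y ρ (imp d e)  = p-imp (translate-pure (opposite p) y ρ d) (translate-pure p y ρ e)
translate-pure p y ρ (ball t d) = flatten-pure p y ρ t (p-ball zero (translate-pure p _ _ d))
translate-pure p y ρ (bex t d)  = flatten-pure p y ρ t (p-bex zero (translate-pure p _ _ d))

translateΣ-pure : ∀ {n m} (y : Fin m) (ρ : Renaming n m) {φ} (s : IsΣ1 φ) →
  IsPureΔ0 (translateΣ y ρ s)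
translateΣ-pure y ρ (delta d) = translate-pure ⁺ y ρ d
translateΣ-pure y ρ (ex s)    = p-bex y (translateΣ-pure (suc y) (lift ρ) s)

module Semantics (M : Structure) where
  open Structure M

  evalT-wk : ∀ {n} {γ : Vec Carrier n} a (t : Term n) → evalT M (a ∷ γ) (wk t) ≡ evalT M γ t
  evalT-wk a (var i)  = refl
  evalT-wk a `0       = refl
  evalT-wk a (`S t)   = cong s (evalT-wk a t)
  evalT-wk a (t `+ u) = cong₂ add (evalT-wk a t) (evalT-wk a u)
  evalT-wk a (t `× u) = cong₂ mul (evalT-wk a t) (evalT-wk a u)

  evalT-rename : ∀ {n m} {ρ : Renaming n m} {δ γ} → Agree ρ δ γ →
    ∀ t → evalT M δ (renameᵗ ρ t) ≡ evalT M γ t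
  evalT-rename ag (var i)  = lookup-agree ag i
  evalT-rename ag `0       = refl
  evalT-rename ag (`S t)   = cong s (evalT-rename ag t)
  evalT-rename ag (t `+ u) = cong₂ add (evalT-rename ag t) (evalT-rename ag u)
  evalT-rename ag (t `× u) = cong₂ mul (evalT-rename ag t) (evalT-rename ag u)

  Sat-stable : ∀ {n} {γ : Vec Carrier n} φ → Stable (Sat M γ φ)
  Sat-stable (t ≐ u)    = negated-stable
  Sat-stable (t ≼ u)    = negated-stable
  Sat-stable (¬' φ)     = negated-stable
  Sat-stable (φ ∧' ψ) h =
    Sat-stable φ (¬¬-map Product.proj₁ h) , Sat-stable ψ (¬¬-map Product.proj₂ h)
  Sat-stable (φ ∨' ψ)   = negated-stable
  Sat-stable (φ ⇒' ψ) h = λ x → Sat-stable ψ (¬¬-map (λ f → f x) h)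
  Sat-stable (∀' φ)   h = λ a → Sat-stable φ (¬¬-map (λ f → f a) h)
  Sat-stable (∃' φ)     = negated-stable

  Sat-subst : ∀ {n} {γ : Vec Carrier n} {a b} φ → ¬ ¬ a ≡ b → Sat M (a ∷ γ) φ → Sat M (b ∷ γ) φ
  Sat-subst φ a≡b h = Sat-stable φ (¬¬-map (λ { refl → h }) a≡b)

  Sat-rename : ∀ {n m} {ρ : Renaming n m} {δ γ} → Agree ρ δ γ →
    ∀ φ → Sat M δ (rename ρ φ) ⇔ Sat M γ φ
  Sat-rename ag (t ≐ u)  = ¬¬-cong₂ _≡_ (evalT-rename ag t) (evalT-rename ag u)
  Sat-rename ag (t ≼ u)  = ¬¬-cong₂ leq (evalT-rename ag t) (evalT-rename ag u)
  Sat-rename ag (¬' φ)   = ¬-cong-⇔ (Sat-rename ag φ)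
  Sat-rename ag (φ ∧' ψ) = Sat-rename ag φ ×-⇔ Sat-rename ag ψ
  Sat-rename ag (φ ∨' ψ) = ¬-cong-⇔ (¬-cong-⇔ (Sat-rename ag φ ⊎-⇔ Sat-rename ag ψ))
  Sat-rename ag (φ ⇒' ψ) = →-cong-⇔ (Sat-rename ag φ) (Sat-rename ag ψ)
  Sat-rename ag (∀' φ)   = mk⇔
    (λ h a → to (Sat-rename (agree-lift a ag) φ) (h a))
    (λ h a → from (Sat-rename (agree-lift a ag) φ) (h a))
  Sat-rename ag (∃' φ)   = ¬-cong-⇔ (¬-cong-⇔ (mk⇔
    (λ (a , h) → a , to (Sat-rename (agree-lift a ag) φ) h)
    (λ (a , h) → a , from (Sat-rename (agree-lift a ag) φ) h)))

  Sat-∀≤ : ∀ {n} {γ : Vec Carrier n} t φ →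
    Sat M γ (∀≤ t φ) ⇔ ((x : Carrier) → ¬ ¬ leq x (evalT M γ t) → Sat M (x ∷ γ) φ)
  Sat-∀≤ t φ = mk⇔
    (λ h x → h x ∘ subst (λ v → ¬ ¬ leq x v) (sym (evalT-wk x t)))
    (λ h x → h x ∘ subst (λ v → ¬ ¬ leq x v) (evalT-wk x t))

  Sat-∃≤ : ∀ {n} {γ : Vec Carrier n} t φ →
    Sat M γ (∃≤ t φ) ⇔ (¬ ¬ (Σ[ x ∈ Carrier ] ¬ ¬ leq x (evalT M γ t) × Sat M (x ∷ γ) φ))
  Sat-∃≤ t φ = mk⇔
    (¬¬-map λ (x , x≤t , h) → x , subst (λ v → ¬ ¬ leq x v) (evalT-wk x t) x≤t , h)
    (¬¬-map λ (x , x≤t , h) → x , subst (λ v → ¬ ¬ leq x v) (sym (evalT-wk x t)) x≤t , h)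

  Sat-skip₁ : ∀ {m} {δ : Vec Carrier m} {a c} K →
    Sat M (c ∷ a ∷ δ) (rename (lift suc) K) ⇔ Sat M (c ∷ δ) K
  Sat-skip₁ = Sat-rename (agree-lift _ (agree-weaken agree-id))

  Sat-skip₂ : ∀ {m} {δ : Vec Carrier m} {a b c} K →
    Sat M (c ∷ a ∷ b ∷ δ) (rename (lift (suc ∘ suc)) K) ⇔ Sat M (c ∷ δ) K
  Sat-skip₂ = Sat-rename (agree-lift _ (agree-weaken (agree-weaken agree-id)))

  define⁺-sound : ∀ {m} {δ : Vec Carrier m} y e K →
    Sat M δ (define ⁺ y e K) → Sat M (evalT M δ e ∷ δ) K
  define⁺-sound y e K = Sat-stable K ∘ ¬¬-map λ (c , _ , e≡c , h) →
    Sat-subst K (¬¬-map (λ p → trans (sym p) (evalT-wk c e)) e≡c) h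

  define⁻-sound : ∀ {m} {δ : Vec Carrier m} y e K →
    Sat M (evalT M δ e ∷ δ) K → Sat M δ (define ⁻ y e K)
  define⁻-sound y e K h c _ e≡c = Sat-subst K (¬¬-map (trans (sym (evalT-wk c e))) e≡c) h

  define-⇔ : ∀ p {m} {δ : Vec Carrier m} y e K → leq (evalT M δ e) (lookup δ y) →
    Sat M δ (define p y e K) ⇔ Sat M (evalT M δ e ∷ δ) K
  define-⇔ ⁺ y e K e≤y = mk⇔ (define⁺-sound y e K)
    (λ h → contradiction (_ , contradiction e≤y , contradiction (evalT-wk _ e) , h))
  define-⇔ ⁻ y e K e≤y = mk⇔ (λ h → h _ (contradiction e≤y) (contradiction (evalT-wk _ e)))
    (define⁻-sound y e K)

  flatten⁺-sound : ∀ {n m} {ρ : Renaming n m} {δ γ} y → Agree ρ δ γ → ∀ t K →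
    Sat M δ (flatten ⁺ y ρ t K) → Sat M (evalT M γ t ∷ δ) K
  flatten₂⁺-sound : ∀ {n m} {ρ : Renaming n m} {δ γ} y → Agree ρ δ γ → ∀ t u K →
    Sat M δ (flatten₂ ⁺ y ρ t u K) → Sat M (evalT M γ u ∷ evalT M γ t ∷ δ) K
  flatten⁺-sound y ag (var i)  K = to (Sat-rename (agree-var ag i) K)
  flatten⁺-sound y ag `0       K = define⁺-sound y `0 K
  flatten⁺-sound y ag (`S t)   K =
    to (Sat-skip₁ K)
    ∘ define⁺-sound (suc y) (`S (var zero)) _
    ∘ flatten⁺-sound y ag t _
  flatten⁺-sound y ag (t `+ u) K =
    to (Sat-skip₂ K)
    ∘ define⁺-sound (suc (suc y)) (var (suc zero) `+ var zero) _
    ∘ flatten₂⁺-sound y ag t u _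
  flatten⁺-sound y ag (t `× u) K =
    to (Sat-skip₂ K)
    ∘ define⁺-sound (suc (suc y)) (var (suc zero) `× var zero) _
    ∘ flatten₂⁺-sound y ag t u _
  flatten₂⁺-sound y ag t u K =
    flatten⁺-sound (suc y) (agree-weaken ag) u K ∘ flatten⁺-sound y ag t _

  flatten⁻-sound : ∀ {n m} {ρ : Renaming n m} {δ γ} y → Agree ρ δ γ → ∀ t K →
    Sat M (evalT M γ t ∷ δ) K → Sat M δ (flatten ⁻ y ρ t K)
  flatten₂⁻-sound : ∀ {n m} {ρ : Renaming n m} {δ γ} y → Agree ρ δ γ → ∀ t u K →
    Sat M (evalT M γ u ∷ evalT M γ t ∷ δ) K → Sat M δ (flatten₂ ⁻ y ρ t u K)
  flatten⁻-sound y ag (var i)  K = from (Sat-rename (agree-var ag i) K)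
  flatten⁻-sound y ag `0       K = define⁻-sound y `0 K
  flatten⁻-sound y ag (`S t)   K =
    flatten⁻-sound y ag t _
    ∘ define⁻-sound (suc y) (`S (var zero)) _
    ∘ from (Sat-skip₁ K)
  flatten⁻-sound y ag (t `+ u) K =
    flatten₂⁻-sound y ag t u _
    ∘ define⁻-sound (suc (suc y)) (var (suc zero) `+ var zero) _
    ∘ from (Sat-skip₂ K)
  flatten⁻-sound y ag (t `× u) K =
    flatten₂⁻-sound y ag t u _
    ∘ define⁻-sound (suc (suc y)) (var (suc zero) `× var zero) _
    ∘ from (Sat-skip₂ K)
  flatten₂⁻-sound y ag t u K =
    flatten⁻-sound y ag t _ ∘ flatten⁻-sound (suc y) (agree-weaken ag) u K

  translate⁺-sound : ∀ {n m} {ρ : Renaming n m} {δ γ} y → Agree ρ δ γ →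
    {φ : Formula n} (d : IsΔ0 φ) → Sat M δ (translate ⁺ y ρ d) → Sat M γ φ
  translate⁻-sound : ∀ {n m} {ρ : Renaming n m} {δ γ} y → Agree ρ δ γ →
    {φ : Formula n} (d : IsΔ0 φ) → Sat M γ φ → Sat M δ (translate ⁻ y ρ d)
  translate⁺-sound y ag (eq t u)   = flatten₂⁺-sound y ag t u _
  translate⁺-sound y ag (le t u)   = flatten₂⁺-sound y ag t u _
  translate⁺-sound y ag (neg d) h  = h ∘ translate⁻-sound y ag d
  translate⁺-sound y ag (conj d e) =
    Product.map (translate⁺-sound y ag d) (translate⁺-sound y ag e)
  translate⁺-sound y ag (disj d e) =
    ¬¬-map (Sum.map (translate⁺-sound y ag d) (translate⁺-sound y ag e))
  translate⁺-sound y ag (imp d e) h = translate⁺-sound y ag e ∘ h ∘ translate⁻-sound y ag d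
  translate⁺-sound y ag (ball t d) h = from (Sat-∀≤ t _) λ x x≤t →
    translate⁺-sound _ (agree-lift x (agree-weaken ag)) d (flatten⁺-sound y ag t _ h x x≤t)
  translate⁺-sound y ag (bex t d) h = from (Sat-∃≤ t _) (¬¬-map
    (λ (x , x≤t , hx) → x , x≤t , translate⁺-sound _ (agree-lift x (agree-weaken ag)) d hx)
    (flatten⁺-sound y ag t _ h))
  translate⁻-sound y ag (eq t u)   = flatten₂⁻-sound y ag t u _
  translate⁻-sound y ag (le t u)   = flatten₂⁻-sound y ag t u _
  translate⁻-sound y ag (neg d) h  = h ∘ translate⁺-sound y ag d
  translate⁻-sound y ag (conj d e) =
    Product.map (translate⁻-sound y ag d) (translate⁻-sound y ag e)
  translate⁻-sound y ag (disj d e) =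
    ¬¬-map (Sum.map (translate⁻-sound y ag d) (translate⁻-sound y ag e))
  translate⁻-sound y ag (imp d e) h = translate⁻-sound y ag e ∘ h ∘ translate⁺-sound y ag d
  translate⁻-sound y ag (ball t d) h = flatten⁻-sound y ag t _ λ x x≤t →
    translate⁻-sound _ (agree-lift x (agree-weaken ag)) d (to (Sat-∀≤ t _) h x x≤t)
  translate⁻-sound y ag (bex t d) h = flatten⁻-sound y ag t _ (¬¬-map
    (λ (x , x≤t , hx) → x , x≤t , translate⁻-sound _ (agree-lift x (agree-weaken ag)) d hx)
    (to (Sat-∃≤ t _) h))

  translateΣ-sound : ∀ {n m} {ρ : Renaming n m} {δ γ} y → Agree ρ δ γ →
    {φ : Formula n} (s : IsΣ1 φ) → Sat M δ (translateΣ y ρ s) → Sat M γ φ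
  translateΣ-sound y ag (delta d) = translate⁺-sound y ag d
  translateΣ-sound y ag (ex s)    =
    ¬¬-map λ (x , _ , hx) → x , translateΣ-sound (suc y) (agree-lift x ag) s hx

open Semantics ℕ-model

⟦_⟧_ : ∀ {n} → Term n → Vec ℕ n → ℕ
⟦ t ⟧ γ = evalT ℕ-model γ t

termBound : ∀ {n} → Vec ℕ n → Term n → ℕ
termBound γ (var i)  = 0
termBound γ `0       = 0
termBound γ (`S t)   = termBound γ t + ⟦ `S t ⟧ γ
termBound γ (t `+ u) = (termBound γ t + termBound γ u) + ⟦ t `+ u ⟧ γ
termBound γ (t `× u) = (termBound γ t + termBound γ u) + ⟦ t `× u ⟧ γ

sumUpTo : ℕ → (ℕ → ℕ) → ℕ
sumUpTo ℕ.zero    f = f 0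
sumUpTo (ℕ.suc n) f = sumUpTo n f + f (ℕ.suc n)

≤-sumUpTo : ∀ {x n} f → x ≤ n → f x ≤ sumUpTo n f
≤-sumUpTo {n = ℕ.zero}  f z≤n = ≤-refl
≤-sumUpTo {n = ℕ.suc n} f x≤1+n with m≤n⇒m<n∨m≡n x≤1+n
... | Sum.inj₁ (ℕ.s≤s x≤n) = ≤-trans (≤-sumUpTo f x≤n) (m≤m+n _ _)
... | Sum.inj₂ refl        = m≤n+m _ _

formulaBound : ∀ {n} → Vec ℕ n → {φ : Formula n} → IsΔ0 φ → ℕ
formulaBound γ (eq t u)   = termBound γ t + termBound γ u
formulaBound γ (le t u)   = termBound γ t + termBound γ u
formulaBound γ (neg d)    = formulaBound γ d
formulaBound γ (conj d e) = formulaBound γ d + formulaBound γ e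
formulaBound γ (disj d e) = formulaBound γ d + formulaBound γ e
formulaBound γ (imp d e)  = formulaBound γ d + formulaBound γ e
formulaBound γ (ball t d) = termBound γ t + sumUpTo (⟦ t ⟧ γ) (λ x → formulaBound (x ∷ γ) d)
formulaBound γ (bex t d)  = termBound γ t + sumUpTo (⟦ t ⟧ γ) (λ x → formulaBound (x ∷ γ) d)

flatten-⇔ : ∀ p {n m} {ρ : Renaming n m} {δ γ} y → Agree ρ δ γ → ∀ t K →
  termBound γ t ≤ lookup δ y → Sat ℕ-model δ (flatten p y ρ t K) ⇔ Sat ℕ-model (⟦ t ⟧ γ ∷ δ) K
flatten₂-⇔ : ∀ p {n m} {ρ : Renaming n m} {δ γ} y → Agree ρ δ γ → ∀ t u K →
  termBound γ t + termBound γ u ≤ lookup δ y →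
  Sat ℕ-model δ (flatten₂ p y ρ t u K) ⇔ Sat ℕ-model (⟦ u ⟧ γ ∷ ⟦ t ⟧ γ ∷ δ) K
flatten-⇔ p y ag (var i)  K _ = Sat-rename (agree-var ag i) K
flatten-⇔ p y ag `0       K _ = define-⇔ p y `0 K z≤n
flatten-⇔ p {γ = γ} y ag (`S t) K b =
  Sat-skip₁ K
  ⇔-∘ (define-⇔ p (suc y) (`S (var zero)) _ (m+n≤o⇒n≤o (termBound γ t) b)
  ⇔-∘ flatten-⇔ p y ag t _ (m+n≤o⇒m≤o (termBound γ t) b))
flatten-⇔ p {γ = γ} y ag (t `+ u) K b =
  Sat-skip₂ K
  ⇔-∘ (define-⇔ p (suc (suc y)) (var (suc zero) `+ var zero) _
         (m+n≤o⇒n≤o (termBound γ t + termBound γ u) b)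
  ⇔-∘ flatten₂-⇔ p y ag t u _ (m+n≤o⇒m≤o (termBound γ t + termBound γ u) b))
flatten-⇔ p {γ = γ} y ag (t `× u) K b =
  Sat-skip₂ K
  ⇔-∘ (define-⇔ p (suc (suc y)) (var (suc zero) `× var zero) _
         (m+n≤o⇒n≤o (termBound γ t + termBound γ u) b)
  ⇔-∘ flatten₂-⇔ p y ag t u _ (m+n≤o⇒m≤o (termBound γ t + termBound γ u) b))
flatten₂-⇔ p {γ = γ} y ag t u K b =
  flatten-⇔ p (suc y) (agree-weaken ag) u K (m+n≤o⇒n≤o (termBound γ t) b)
  ⇔-∘ flatten-⇔ p y ag t _ (m+n≤o⇒m≤o (termBound γ t) b)

≤-stable : ∀ {x v} → Stable (x ≤ v)
≤-stable {x} {v} = decidable-stable (x ≤? v)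

∀≤-cong : ∀ {v} {A B : ℕ → Set} → (∀ {x} → x ≤ v → A x ⇔ B x) →
  ((x : ℕ) → ¬ ¬ x ≤ v → A x) ⇔ ((x : ℕ) → ¬ ¬ x ≤ v → B x)
∀≤-cong A⇔B = mk⇔
  (λ h x x≤v → to (A⇔B (≤-stable x≤v)) (h x x≤v))
  (λ h x x≤v → from (A⇔B (≤-stable x≤v)) (h x x≤v))

∃≤-cong : ∀ {v} {A B : ℕ → Set} → (∀ {x} → x ≤ v → A x ⇔ B x) →
  (¬ ¬ (Σ[ x ∈ ℕ ] ¬ ¬ x ≤ v × A x)) ⇔ (¬ ¬ (Σ[ x ∈ ℕ ] ¬ ¬ x ≤ v × B x))
∃≤-cong A⇔B = mk⇔
  (¬¬-map λ (x , x≤v , h) → x , x≤v , to (A⇔B (≤-stable x≤v)) h)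
  (¬¬-map λ (x , x≤v , h) → x , x≤v , from (A⇔B (≤-stable x≤v)) h)

body-bound-≤ : ∀ {n} (γ : Vec ℕ n) t {φ : Formula (ℕ.suc n)} (d : IsΔ0 φ) {B x} →
  termBound γ t + sumUpTo (⟦ t ⟧ γ) (λ x → formulaBound (x ∷ γ) d) ≤ B → x ≤ ⟦ t ⟧ γ →
  formulaBound (x ∷ γ) d ≤ B
body-bound-≤ γ t d b x≤t =
  ≤-trans (≤-sumUpTo (λ x → formulaBound (x ∷ γ) d) x≤t) (m+n≤o⇒n≤o (termBound γ t) b)

translate-⇔ : ∀ p {n m} {ρ : Renaming n m} {δ γ} y → Agree ρ δ γ →
  {φ : Formula n} (d : IsΔ0 φ) → formulaBound γ d ≤ lookup δ y →
  Sat ℕ-model δ (translate p y ρ d) ⇔ Sat ℕ-model γ φ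
translate-⇔ p y ag (eq t u)   b = flatten₂-⇔ p y ag t u _ b
translate-⇔ p y ag (le t u)   b = flatten₂-⇔ p y ag t u _ b
translate-⇔ p y ag (neg d)    b = ¬-cong-⇔ (translate-⇔ (opposite p) y ag d b)
translate-⇔ p {γ = γ} y ag (conj d e) b =
  translate-⇔ p y ag d (m+n≤o⇒m≤o (formulaBound γ d) b)
  ×-⇔ translate-⇔ p y ag e (m+n≤o⇒n≤o (formulaBound γ d) b)
translate-⇔ p {γ = γ} y ag (disj d e) b = ¬-cong-⇔ (¬-cong-⇔
  (translate-⇔ p y ag d (m+n≤o⇒m≤o (formulaBound γ d) b)
   ⊎-⇔ translate-⇔ p y ag e (m+n≤o⇒n≤o (formulaBound γ d) b)))
translate-⇔ p {γ = γ} y ag (imp d e)  b = →-cong-⇔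
  (translate-⇔ (opposite p) y ag d (m+n≤o⇒m≤o (formulaBound γ d) b))
  (translate-⇔ p y ag e (m+n≤o⇒n≤o (formulaBound γ d) b))
translate-⇔ p {γ = γ} y ag (ball t d) b =
  ⇔-sym (Sat-∀≤ t _)
  ⇔-∘ (∀≤-cong (λ x≤t →
          translate-⇔ p _ (agree-lift _ (agree-weaken ag)) d (body-bound-≤ γ t d b x≤t))
  ⇔-∘ flatten-⇔ p y ag t _ (m+n≤o⇒m≤o (termBound γ t) b))
translate-⇔ p {γ = γ} y ag (bex t d)  b =
  ⇔-sym (Sat-∃≤ t _)
  ⇔-∘ (∃≤-cong (λ x≤t →
          translate-⇔ p _ (agree-lift _ (agree-weaken ag)) d (body-bound-≤ γ t d b x≤t))
  ⇔-∘ flatten-⇔ p y ag t _ (m+n≤o⇒m≤o (termBound γ t) b))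

translateΣ-complete : ∀ {n} (γ : Vec ℕ n) {φ} (s : IsΣ1 φ) → Sat ℕ-model γ φ →
  ¬ ¬ (Σ[ B ∈ ℕ ] (∀ {m} {ρ : Renaming n m} {δ} y → Agree ρ δ γ → B ≤ lookup δ y →
                     Sat ℕ-model δ (translateΣ y ρ s)))
translateΣ-complete γ (delta d) h =
  contradiction (formulaBound γ d , λ y ag b → from (translate-⇔ ⁺ y ag d b) h)
translateΣ-complete γ (ex s) h = do
  (c , hc) ← h
  (B , translated) ← translateΣ-complete (c ∷ γ) s hc
  pure (B + c , λ {_} {_} {_} y ag b → contradiction
    (c , contradiction (m+n≤o⇒n≤o B b) , translated (suc y) (agree-lift c ag) (m+n≤o⇒m≤o B b)))
  where open RawMonad ¬¬-Monad

proposition4p3 : (λ′ : Sentence) → IsΣ1 λ′ →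
    Σ[ λ• ∈ Sentence ] (IsPure1Σ1 λ• × (ℕ-model ⊨ (λ′ ⇔' λ•)) × Valid (λ• ⇒' λ′))
proposition4p3 λ′ s =
  ∃' σ , pure1 (translateΣ-pure zero (λ ()) s) , (true-in-ℕ , implies-λ′ ℕ-model) , implies-λ′
  where
  σ : Formula 1
  σ = translateΣ zero (λ ()) s

  implies-λ′ : Valid (∃' σ ⇒' λ′)
  implies-λ′ M = Semantics.Sat-stable M λ′ ∘ ¬¬-map λ (_ , h) →
    Semantics.translateΣ-sound M zero (agree λ ()) s h

  true-in-ℕ : ℕ-model ⊨ λ′ → ℕ-model ⊨ ∃' σ
  true-in-ℕ h = ¬¬-map (λ (B , translated) → B , translated zero (agree λ ()) ≤-refl)
    (translateΣ-complete [] s h)
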